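{- Let $G$ be a finite abelian $p$-group for a prime $p$, let $\psi:G\to\mathbb{Z}_{p^{\alpha_1}}\times\mathbb{Z}_{p^{\alpha_2}}\times\cdots\times\mathbb{Z}_{p^{\alpha_r}}$ (with $r\in\mathbb{N}$, $\alpha_i\in\mathbb{N}$) be an isomorphism, and let $t$ be an index with $\tau(G)=p^{\alpha_t}$. If $g\in G$ is such that all components of $\psi(g)$ are $\overline{0}$ except the $t$-th, which is $\overline{a}$ with $\gcd(a,p)=1$, then $E\big[g,\ \psi^{ -1}(\langle\psi(g)\rangle)\setminus\{g\}\big]$ is a minimum disconnecting set of $\mathcal{G}(G)$.
   Context: $\mathbb{Z}_m$ is the additive group of integers modulo $m$. A finite abelian group $G$ is isomorphic to a unique direct product of cyclic groups of prime power order; $\tau(G)$ is the order of the smallest cyclic factor. The power graph $\mathcal{G}(G)$ has vertex set $G$, distinct $u,v$ adjacent iff one is a positive integer power of the other. $E[x,B]$ is the set of edges with one end $x$ and the other in $B$. A disconnecting set is a set of edges whose removal increases the number of components; a minimum disconnecting set is one of least cardinality. -}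

module Defs where

open import Level using (Level; _⊔_; 0ℓ)
open import Algebra.Bundles using (AbelianGroup)
open import Algebra.Bundles.Raw using (RawGroup)
open import Data.Nat using (ℕ; zero; suc; _*_; _∸_; _≤_; _<_; _^_; NonZero)
open import Data.Nat.Properties using (m^n≢0)
open import Data.Nat.DivMod using (_mod_)
open import Data.Nat.Primality using (Prime; prime⇒nonZero)
open import Data.Fin using (Fin; toℕ)
open import Data.Integer using (ℤ; +_; -[1+_])
open import Data.Product using (Σ; ∃; ∃₂; ∃-syntax; _×_; _,_)
open import Data.Sum using (_⊎_)
open import Data.List using (List; length)
open import Data.List.Relation.Unary.All using (All)
open import Data.List.Relation.Unary.Any using (Any)
open import Data.List.Relation.Unary.AllPairs using (AllPairs)
open import Relation.Nullary using (¬_)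
open import Relation.Binary.PropositionalEquality using (_≡_)

-- The group Z_{p^α₁} × ⋯ × Z_{p^α_r}  (p prime), elements are tuples
-- of residues, Z_m represented by Fin m with addition modulo m.

module CyclicProduct (p : ℕ) (pp : Prime p) {r : ℕ} (α : Fin r → ℕ) where

  private
    instance
      p≢0 : NonZero p
      p≢0 = prime⇒nonZero pp

    m : Fin r → ℕ
    m i = p ^ α i

    instance
      m≢0 : {i : Fin r} → NonZero (m i)
      m≢0 {i} = m^n≢0 p (α i)

  Carrier : Set
  Carrier = (i : Fin r) → Fin (m i)

  _≈_ : Carrier → Carrier → Set
  x ≈ y = ∀ i → x i ≡ y i

  _+_ : Carrier → Carrier → Carrier
  (x + y) i = (toℕ (x i) Data.Nat.+ toℕ (y i)) mod m i

  0# : Carrier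
  0# i = 0 mod m i

  -_ : Carrier → Carrier
  (- x) i = (m i ∸ toℕ (x i)) mod m i

  rawGroup : RawGroup 0ℓ 0ℓ
  rawGroup = record { Carrier = Carrier ; _≈_ = _≈_ ; _∙_ = _+_ ; ε = 0# ; _⁻¹ = -_ }

  _·_ : ℤ → Carrier → Carrier
  ((+ k) · x) i = (k * toℕ (x i)) mod m i
  (-[1+ k ] · x) i = (- (λ j → (suc k * toℕ (x j)) mod m j)) i

  _∈⟨_⟩ : Carrier → Carrier → Set
  y ∈⟨ x ⟩ = ∃[ k ] (y ≈ (k · x))

module PowerGraph {c ℓ : Level} (G : AbelianGroup c ℓ) where

  open AbelianGroup G

  pow : Carrier → ℕ → Carrier
  pow x zero = ε
  pow x (suc k) = x ∙ pow x k

  IsPowerOf : Carrier → Carrier → Set ℓ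
  IsPowerOf u v = ∃[ k ] (1 ≤ k × u ≈ pow v k)

  Adj : Carrier → Carrier → Set ℓ
  Adj u v = ¬ (u ≈ v) × (IsPowerOf u v ⊎ IsPowerOf v u)

  -- an (undirected) edge {u , v} is represented by an ordered pair,
  -- two pairs representing the same edge when equal up to swapping
  Edge : Set c
  Edge = Carrier × Carrier

  _≈ₑ_ : Edge → Edge → Set ℓ
  (u , v) ≈ₑ (u' , v') = (u ≈ u' × v ≈ v') ⊎ (u ≈ v' × v ≈ u')

  _∈ₑ_ : Edge → List Edge → Set (c ⊔ ℓ)
  e ∈ₑ L = Any (e ≈ₑ_) L

  IsEdgeSet : List Edge → Set (c ⊔ ℓ)
  IsEdgeSet L = All (λ e → Adj (Data.Product.proj₁ e) (Data.Product.proj₂ e)) L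
              × AllPairs (λ e e' → ¬ (e ≈ₑ e')) L

  Enumerates : {s : Level} → List Edge → (Edge → Set s) → Set (c ⊔ ℓ ⊔ s)
  Enumerates L S = All S L × AllPairs (λ e e' → ¬ (e ≈ₑ e')) L
                 × (∀ e → S e → e ∈ₑ L)

  AdjWithout : List Edge → Carrier → Carrier → Set (c ⊔ ℓ)
  AdjWithout L u v = Adj u v × ¬ ((u , v) ∈ₑ L)

  data Reach {r : Level} (R : Carrier → Carrier → Set r) : Carrier → Carrier → Set (c ⊔ ℓ ⊔ r) where
    here : ∀ {u v} → u ≈ v → Reach R u v
    step : ∀ {u w v} → R u w → Reach R w v → Reach R u v

  HasComponents : {r : Level} → (Carrier → Carrier → Set r) → ℕ → Set (c ⊔ ℓ ⊔ r)
  HasComponents R k = ∃[ reps ] (length reps ≡ k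
                        × AllPairs (λ a b → ¬ Reach R a b) reps
                        × (∀ v → Any (λ a → Reach R a v) reps))

  Disconnecting : List Edge → Set (c ⊔ ℓ)
  Disconnecting L = ∃₂ λ k k' → HasComponents Adj k
                              × HasComponents (AdjWithout L) k' × k < k'

  IsMinDisconnecting : List Edge → Set (c ⊔ ℓ)
  IsMinDisconnecting L = IsEdgeSet L × Disconnecting L
    × (∀ L' → IsEdgeSet L' → Disconnecting L' → length L ≤ length L')

  E[_,_] : {b : Level} → Carrier → (Carrier → Set b) → Edge → Set (ℓ ⊔ b)
  E[ x , B ] (u , v) = Adj u v × ((u ≈ x × B v) ⊎ (v ≈ x × B u))

-- Upper bound: g is not a p-th power and prime-to-p powers are invertible, so all neighbours
-- of g lie in ⟨g⟩; removing these τ − 1 edges isolates g, while ε stays adjacent to the rest.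
-- Lower bound: each x ≠ ε is z^(p^s) with z of order ≥ τ, hence comparable with the other
-- τ − 1 elements of z¹, …, z^τ.  When ε is adjacent to everything, a disconnecting set must,
-- for some x ≠ ε and every neighbour y of x, contain y–x or ε–y; these edges are distinct,
-- so it has at least τ − 1 edges (pigeonhole).

module Submission where

open import Level using (Level; _⊔_)
open import Algebra.Bundles using (AbelianGroup)
open import Algebra.Morphism.Structures using (module GroupMorphisms)
open import Data.Empty using (⊥; ⊥-elim)
open import Data.Fin using (Fin; toℕ; zero; suc; fromℕ<)
import Data.Fin as Fin
open import Data.Fin.Properties using (all?; ¬∀⟶∃¬; toℕ-fromℕ<; toℕ-injective; toℕ<n)
open import Data.Integer using (+_; -[1+_])
open import Data.List using (List; []; _∷_; length; applyUpTo; map)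
open import Data.List.Properties using (length-map; length-removeAt; length-removeAt′; length-applyUpTo)
open import Data.List.Membership.Propositional.Properties using (∈-applyUpTo⁺)
open import Data.List.Relation.Unary.All using (All; []; _∷_)
import Data.List.Relation.Unary.All as All
import Data.List.Relation.Unary.All.Properties as All
open import Data.List.Relation.Unary.Any using (Any; here; there)
import Data.List.Relation.Unary.Any as Any
import Data.List.Relation.Unary.Any.Properties as Any
open import Data.List.Relation.Unary.AllPairs using (AllPairs; []; _∷_)
import Data.List.Relation.Unary.AllPairs as AllPairs
import Data.List.Relation.Unary.AllPairs.Properties as AllPairs
open import Data.Nat using (ℕ; zero; suc; pred; _+_; _*_; _∸_; _^_; _≤_; _<_; _%_; z≤n; s≤s;
  NonZero; >-nonZero; >-nonZero⁻¹; nonTrivial⇒n>1)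
open import Data.Nat.Properties
open import Data.Nat.DivMod using (_/_; _mod_; m≡m%n+[m/n]*n; [m+kn]%n≡m%n; %-distribˡ-+; m%n%n≡m%n;
  m*n%n≡0; m<n⇒m%n≡m; m%n<n)
open import Data.Nat.Divisibility
open import Data.Nat.Coprimality using (Coprime; coprime-divisor; coprime-Bézout; gcd≡1⇒coprime)
import Data.Nat.Coprimality as Coprimality
open import Data.Nat.GCD using (gcd; module Bézout)
open import Data.Nat.Primality using (Prime; prime⇒irreducible; prime⇒nonZero; prime⇒nonTrivial; ¬prime[1])
open import Data.Nat.Tactic.RingSolver using (solve-∀)
open import Data.Product using (∃; ∃₂; ∃-syntax; _×_; _,_; proj₁; proj₂)
open import Data.Sum using (_⊎_; inj₁; inj₂)
import Data.Sum as Sum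
open import Relation.Binary.Bundles using (Setoid)
open import Relation.Binary.Definitions using (Decidable)
open import Relation.Binary.PropositionalEquality using (_≡_; refl; sym; trans; cong; subst; module ≡-Reasoning)
open import Relation.Nullary using (¬_; Dec; yes; no; contradiction; ¬?)
open import Relation.Nullary.Decidable using (_×-dec_; _⊎-dec_)
import Relation.Nullary.Decidable as Dec

open import Defs

-- Arithmetic: powers of a prime, residues, and dividing out p.

^-∣ : ∀ p {a b} → a ≤ b → p ^ a ∣ p ^ b
^-∣ p {a} {b} a≤b = divides (p ^ (b ∸ a)) (begin
  p ^ b               ≡⟨ cong (p ^_) (m+[n∸m]≡n a≤b) ⟨
  p ^ (a + (b ∸ a))   ≡⟨ ^-distribˡ-+-* p a (b ∸ a) ⟩
  p ^ a * p ^ (b ∸ a) ≡⟨ *-comm (p ^ a) _ ⟩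
  p ^ (b ∸ a) * p ^ a ∎)
  where open ≡-Reasoning

∣-<⇒≡0 : ∀ {d n} → d ∣ n → n < d → n ≡ 0
∣-<⇒≡0 {n = zero}  _   _   = refl
∣-<⇒≡0 {n = suc n} d∣n n<d = contradiction (∣⇒≤ d∣n) (<⇒≱ n<d)

+-%-absorb : ∀ a b d .{{_ : NonZero d}} → (a + b % d) % d ≡ (a + b) % d
+-%-absorb a b d = begin
  (a + b % d) % d           ≡⟨ %-distribˡ-+ a (b % d) d ⟩
  (a % d + b % d % d) % d   ≡⟨ cong (λ z → (a % d + z) % d) (m%n%n≡m%n b d) ⟩
  (a % d + b % d) % d       ≡⟨ %-distribˡ-+ a b d ⟨
  (a + b) % d               ∎
  where open ≡-Reasoning

sumᶠ : ∀ {r} → (Fin r → ℕ) → ℕ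
sumᶠ {zero}  α = 0
sumᶠ {suc r} α = α zero + sumᶠ (λ i → α (suc i))

≤-sumᶠ : ∀ {r} (α : Fin r → ℕ) i → α i ≤ sumᶠ α
≤-sumᶠ α zero    = m≤m+n (α zero) _
≤-sumᶠ α (suc i) = ≤-trans (≤-sumᶠ (λ i → α (suc i)) i) (m≤n+m _ (α zero))

^-cancelʳ-≤ : ∀ {p a b} → 1 < p → p ^ a ≤ p ^ b → a ≤ b
^-cancelʳ-≤ {p} {a} {b} p>1 pᵃ≤pᵇ with a ≤? b
... | yes a≤b = a≤b
... | no  a≰b = contradiction pᵃ≤pᵇ (<⇒≱ (^-monoʳ-< p p>1 (≰⇒> a≰b)))

gcd≡1⇒∤ : ∀ {p a} → Prime p → gcd a p ≡ 1 → ¬ p ∣ a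
gcd≡1⇒∤ pp gcd≡1 p∣a = ¬prime[1] (subst Prime (gcd≡1⇒coprime gcd≡1 (p∣a , ∣-refl)) pp)

coprime-^ : ∀ {p k} → Prime p → ¬ p ∣ k → ∀ n → Coprime k (p ^ n)
coprime-^ pp p∤k zero          (_ , d∣1)     = ∣1⇒≡1 d∣1
coprime-^ {p} {k} pp p∤k (suc n) {d} (d∣k , d∣p^1+n) =
  coprime-^ pp p∤k n (d∣k , coprime-divisor d⊥p d∣p^1+n)
  where
  d⊥p : Coprime d p
  d⊥p {e} (e∣d , e∣p) with prime⇒irreducible pp e∣p
  ... | inj₁ e≡1  = e≡1
  ... | inj₂ refl = contradiction (∣-trans e∣d d∣k) p∤k

^∣-cancel-unit : ∀ {p c j w} → Prime p → ¬ p ∣ w → p ^ c ∣ j * w → p ^ c ∣ j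
^∣-cancel-unit {p} {c} {j} {w} pp p∤w d =
  coprime-divisor (Coprimality.sym (coprime-^ pp p∤w c)) (subst (p ^ c ∣_) (*-comm j w) d)

-- If p^(b+c) ∣ j·z while p^(1+b) ∤ z, then p^c ∣ j: z contributes at most b factors p.
^∣-cancel : ∀ {p} → Prime p → ∀ b {c j z} → p ^ (b + c) ∣ j * z → ¬ p ^ suc b ∣ z → p ^ c ∣ j
^∣-cancel {p} pp zero {c} {z = z} d p¹∤z =
  ^∣-cancel-unit {c = c} pp (λ p∣z → p¹∤z (subst (_∣ z) (sym (*-identityʳ p)) p∣z)) d
^∣-cancel {p} pp (suc b) {c} {j} {z} d p^2+b∤z with p ∣? z
... | no p∤z = ^∣-cancel-unit {c = c} pp p∤z (∣-trans (^-∣ p (m≤n+m c (suc b))) d)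
... | yes (divides q refl) = ^∣-cancel pp b (*-cancelˡ-∣ p p·p^[b+c]∣p·jq) p^1+b∤q
  where
  instance
    p≢0 : NonZero p
    p≢0 = prime⇒nonZero pp
  p·p^[b+c]∣p·jq : p * p ^ (b + c) ∣ p * (j * q)
  p·p^[b+c]∣p·jq = subst (p * p ^ (b + c) ∣_) (regroup j q p) d
    where
    regroup : ∀ j q p → j * (q * p) ≡ p * (j * q)
    regroup = solve-∀
  p^1+b∤q : ¬ p ^ suc b ∣ q
  p^1+b∤q h = p^2+b∤z (subst (_∣ q * p) (*-comm (p ^ suc b) p) (*-monoˡ-∣ p h))

%-inverse : ∀ {k N} .{{_ : NonZero N}} → Coprime k N → ∃ λ k' → 1 ≤ k' × (k * k') % N ≡ 1 % N
%-inverse {k} {N} k⊥N =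
  let k' , inv = residue-inverse (coprime-Bézout k⊥N) in
  k' + N , ≤-trans (>-nonZero⁻¹ N) (m≤n+m N k') , (begin
    (k * (k' + N)) % N     ≡⟨ cong (_% N) (*-distribˡ-+ k k' N) ⟩
    (k * k' + k * N) % N   ≡⟨ [m+kn]%n≡m%n (k * k') k N ⟩
    (k * k') % N           ≡⟨ inv ⟩
    1 % N                  ∎)
  where
  open ≡-Reasoning
  residue-inverse : ∀ {N} .{{_ : NonZero N}} → Bézout.Identity 1 k N → ∃ λ k' → (k * k') % N ≡ 1 % N
  residue-inverse {N} (Bézout.+- x y eq) = x , (begin
    (k * x) % N     ≡⟨ cong (_% N) (*-comm k x) ⟩
    (x * k) % N     ≡⟨ cong (_% N) eq ⟨
    (1 + y * N) % N ≡⟨ [m+kn]%n≡m%n 1 y N ⟩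
    1 % N           ∎)
  residue-inverse {N@(suc n)} (Bézout.-+ x y eq) = n * x , (begin
    (k * (n * x)) % N         ≡⟨ [m+kn]%n≡m%n (k * (n * x)) 1 N ⟨
    (k * (n * x) + 1 * N) % N ≡⟨ cong (_% N) (begin
      k * (n * x) + 1 * N       ≡⟨ expand k n x ⟩
      1 + n * (1 + x * k)       ≡⟨ cong (λ w → 1 + n * w) eq ⟩
      1 + n * (y * N)           ≡⟨ cong (λ w → 1 + w) (*-assoc n y N) ⟨
      1 + n * y * N             ∎) ⟩
    (1 + n * y * N) % N       ≡⟨ [m+kn]%n≡m%n 1 (n * y) N ⟩
    1 % N                     ∎)
    where
    expand : ∀ k n x → k * (n * x) + 1 * suc n ≡ 1 + n * (1 + x * k)
    expand = solve-∀

peel : ∀ {p r} .{{_ : NonZero p}} (β : Fin r → ℕ) a (x : Fin r → ℕ) →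
       (∀ i → x i < p ^ (a + β i)) → ¬ (∀ i → x i ≡ 0) →
       ∃₂ λ s (z : Fin r → ℕ) → s ≤ a × (∃ λ i → ¬ p ^ suc (β i) ∣ z i) × (∀ i → x i ≡ p ^ s * z i)
peel {p} {r} β a x x< x≢0 with all? (λ i → p ^ suc (β i) ∣? x i)
... | no ¬all = 0 , x , z≤n , ¬∀⟶∃¬ r _ (λ i → p ^ suc (β i) ∣? x i) ¬all ,
                λ i → sym (+-identityʳ (x i))
peel {p} β zero x x< x≢0 | yes all =
  contradiction (λ i → ∣-<⇒≡0 (all i) (<-≤-trans (x< i) (m≤n*m (p ^ β i) p))) x≢0
peel {p} {r} β (suc a) x x< x≢0 | yes all =
  let s , z , s≤a , unpeelable , x'≡ = peel β a x' x'< x'≢0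
  in suc s , z , s≤s s≤a , unpeelable ,
     λ i → trans (x≡p*x' i) (trans (cong (p *_) (x'≡ i)) (sym (*-assoc p (p ^ s) (z i))))
  where
  p∣x : ∀ i → p ∣ x i
  p∣x i = ∣-trans (m∣m*n (p ^ β i)) (all i)
  x' : Fin r → ℕ
  x' i = quotient (p∣x i)
  x≡p*x' : ∀ i → x i ≡ p * x' i
  x≡p*x' i = m∣n⇒n≡m*quotient (p∣x i)
  x'< : ∀ i → x' i < p ^ (a + β i)
  x'< i = *-cancelˡ-< p _ _ (subst (_< p ^ suc (a + β i)) (x≡p*x' i) (x< i))
  x'≢0 : ¬ (∀ i → x' i ≡ 0)
  x'≢0 h = x≢0 (λ i → trans (x≡p*x' i) (trans (cong (p *_) (h i)) (*-zeroʳ p)))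

-- Counting in lists: removing an entry, and the pigeonhole principle.

survive : ∀ {a p q} {A : Set a} {P : A → Set p} {Q : A → Set q} {ys} →
          (w : Any P ys) → Any Q ys → (∀ {y} → P y → Q y → ⊥) → Any Q (ys Any.─ w)
survive (here _)  (there v) _    = v
survive (there _) (here qy) _    = here qy
survive (here py) (here qy) excl = ⊥-elim (excl py qy)
survive (there w) (there v) excl = there (survive w v excl)

pigeonhole : ∀ {a b d q} {A : Set a} {B : Set b} {D : A → A → Set d} {Q : A → B → Set q} →
             (∀ {x x' e} → D x x' → Q x e → Q x' e → ⊥) →
             ∀ {xs ys} → AllPairs D xs → All (λ x → Any (Q x) ys) xs → length xs ≤ length ys
pigeonhole excl []          []       = z≤n
pigeonhole excl {ys = ys} (Dx ∷ Dxs) (w ∷ ws) =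
  subst (_ ≤_) (sym (length-removeAt′ ys (Any.index w)))
    (s≤s (pigeonhole excl Dxs (All.zipWith (λ (d , w') → survive w w' (excl d)) (Dx , ws))))

─-pairwise : ∀ {a p r} {A : Set a} {P : A → Set p} {R : A → A → Set r} {xs} →
             AllPairs R xs → (w : Any P xs) → AllPairs R (xs Any.─ w)
─-pairwise (_ ∷ Rxs)  (here _)  = Rxs
─-pairwise (Rx ∷ Rxs) (there w) = All.─⁺ w Rx ∷ ─-pairwise Rxs w

module _ {c ℓ} (S : Setoid c ℓ) where
  open Setoid S using (_≈_) renaming (sym to ≈-sym; trans to ≈-trans)

  ─-avoids : ∀ {x xs} → AllPairs (λ a b → ¬ a ≈ b) xs → (w : Any (x ≈_) xs) →
             All (λ y → ¬ y ≈ x) (xs Any.─ w)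
  ─-avoids (x₀≉ ∷ _) (here x≈x₀) = All.map (λ x₀≉y y≈x → x₀≉y (≈-sym (≈-trans y≈x x≈x₀))) x₀≉
  ─-avoids {x} {x₀ ∷ _} (x₀≉ ∷ ds) (there w) = x₀≉x ∷ ─-avoids ds w
    where
    x₀≉x : ¬ x₀ ≈ x
    x₀≉x x₀≈x = let x₀≉y , x≈y = All.lookupAny x₀≉ w in x₀≉y (≈-trans x₀≈x x≈y)

-- Powers in an abelian group.

module PowerLaws {c ℓ} (G : AbelianGroup c ℓ) where
  open AbelianGroup G renaming (refl to ≈-refl; sym to ≈-sym; trans to ≈-trans; reflexive to ≈-reflexive)
  open PowerGraph G using (pow; IsPowerOf)
  open import Algebra.Properties.AbelianGroup G using (∙-cancelˡ; inverseʳ-unique)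
  open import Relation.Binary.Reasoning.Setoid setoid

  pow-cong : ∀ {x y} n → x ≈ y → pow x n ≈ pow y n
  pow-cong zero    _   = ≈-refl
  pow-cong (suc n) x≈y = ∙-cong x≈y (pow-cong n x≈y)

  pow-one : ∀ x → pow x 1 ≈ x
  pow-one x = identityʳ x

  pow-ε : ∀ n → pow ε n ≈ ε
  pow-ε zero    = ≈-refl
  pow-ε (suc n) = ≈-trans (identityˡ _) (pow-ε n)

  pow-+ : ∀ x a b → pow x (a + b) ≈ pow x a ∙ pow x b
  pow-+ x zero    b = ≈-sym (identityˡ _)
  pow-+ x (suc a) b = begin
    x ∙ pow x (a + b)       ≈⟨ ∙-congˡ (pow-+ x a b) ⟩
    x ∙ (pow x a ∙ pow x b) ≈⟨ assoc x _ _ ⟨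
    x ∙ pow x a ∙ pow x b   ∎

  pow-pow : ∀ x a b → pow (pow x a) b ≈ pow x (a * b)
  pow-pow x a zero    = ≈-reflexive (cong (pow x) (sym (*-zeroʳ a)))
  pow-pow x a (suc b) = begin
    pow x a ∙ pow (pow x a) b ≈⟨ ∙-congˡ (pow-pow x a b) ⟩
    pow x a ∙ pow x (a * b)   ≈⟨ pow-+ x a (a * b) ⟨
    pow x (a + a * b)         ≡⟨ cong (pow x) (*-suc a b) ⟨
    pow x (a * suc b)         ∎

  pow-cancel : ∀ x a d → pow x a ≈ pow x (a + d) → pow x d ≈ ε
  pow-cancel x a d xᵃ≈xᵃ⁺ᵈ = ∙-cancelˡ (pow x a) (pow x d) ε (begin
    pow x a ∙ pow x d ≈⟨ pow-+ x a d ⟨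
    pow x (a + d)     ≈⟨ xᵃ≈xᵃ⁺ᵈ ⟨
    pow x a           ≈⟨ identityʳ _ ⟨
    pow x a ∙ ε       ∎)

  pow-% : ∀ x e .{{_ : NonZero e}} → pow x e ≈ ε → ∀ n → pow x n ≈ pow x (n % e)
  pow-% x e xᵉ≈ε n = begin
    pow x n                           ≡⟨ cong (pow x) (m≡m%n+[m/n]*n n e) ⟩
    pow x (n % e + n / e * e)         ≈⟨ pow-+ x (n % e) (n / e * e) ⟩
    pow x (n % e) ∙ pow x (n / e * e) ≈⟨ ∙-congˡ vanish ⟩
    pow x (n % e) ∙ ε                 ≈⟨ identityʳ _ ⟩
    pow x (n % e)                     ∎
    where
    vanish : pow x (n / e * e) ≈ ε
    vanish = begin
      pow x (n / e * e)     ≡⟨ cong (pow x) (*-comm (n / e) e) ⟩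
      pow x (e * (n / e))   ≈⟨ pow-pow x e (n / e) ⟨
      pow (pow x e) (n / e) ≈⟨ pow-cong (n / e) xᵉ≈ε ⟩
      pow ε (n / e)         ≈⟨ pow-ε (n / e) ⟩
      ε                     ∎

  pow-⁻¹ : ∀ x e n → pow x (suc e) ≈ ε → pow x n ⁻¹ ≈ pow x (n * e)
  pow-⁻¹ x e n xᵉ≈ε = ≈-sym (inverseʳ-unique (pow x n) (pow x (n * e)) (begin
    pow x n ∙ pow x (n * e) ≈⟨ pow-+ x n (n * e) ⟨
    pow x (n + n * e)       ≡⟨ cong (λ k → pow x (n + k)) (*-comm e n) ⟨
    pow x (suc e * n)       ≈⟨ pow-pow x (suc e) n ⟨
    pow (pow x (suc e)) n   ≈⟨ pow-cong n xᵉ≈ε ⟩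
    pow ε n                 ≈⟨ pow-ε n ⟩
    ε                       ∎))

  pow-reduce : ∀ x e .{{_ : NonZero e}} → pow x e ≈ ε → ∀ n → ∃ λ j → 1 ≤ j × j ≤ e × pow x n ≈ pow x j
  pow-reduce x e xᵉ≈ε n with n % e | pow-% x e xᵉ≈ε n | m%n<n n e
  ... | zero  | xⁿ≈ε  | _   = e , >-nonZero⁻¹ e , ≤-refl , ≈-trans xⁿ≈ε (≈-sym xᵉ≈ε)
  ... | suc j | xⁿ≈xʲ | j<e = suc j , s≤s z≤n , <⇒≤ j<e , xⁿ≈xʲ

  IsPowerOf-resp : ∀ {u u' v v'} → u ≈ u' → v ≈ v' → IsPowerOf u v → IsPowerOf u' v'
  IsPowerOf-resp u≈u' v≈v' (k , k≥1 , u≈vᵏ) =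
    k , k≥1 , ≈-trans (≈-sym u≈u') (≈-trans u≈vᵏ (pow-cong k v≈v'))

  powers : Carrier → ℕ → List Carrier
  powers z m = applyUpTo (λ i → pow z (suc i)) m

  OrderAtLeast : ℕ → Carrier → Set ℓ
  OrderAtLeast m z = ∀ d → 1 ≤ d → d < m → ¬ pow z d ≈ ε

  powers-distinct : ∀ {m z} → OrderAtLeast m z → AllPairs (λ a b → ¬ a ≈ b) (powers z m)
  powers-distinct {m} {z} ord = AllPairs.applyUpTo⁺₁ _ m λ {i} {j} i<j j<m zⁱ≈zʲ →
    ord (j ∸ i) (m<n⇒0<n∸m i<j) (≤-<-trans (m∸n≤m j i) j<m)
        (pow-cancel z (suc i) (j ∸ i)
          (≈-trans zⁱ≈zʲ (≈-reflexive (cong (λ n → pow z (suc n)) (sym (m+[n∸m]≡n (<⇒≤ i<j)))))))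

  ∈-powers : ∀ {z m j} → 1 ≤ j → j ≤ m → Any (pow z j ≈_) (powers z m)
  ∈-powers {z} {j = suc i} _ j≤m = Any.map ≈-reflexive (∈-applyUpTo⁺ (λ i → pow z (suc i)) j≤m)

  powers-are-powers : ∀ z m → All (λ y → IsPowerOf y z) (powers z m)
  powers-are-powers z m = All.applyUpTo⁺₁ _ m (λ {i} _ → suc i , s≤s z≤n , ≈-refl)

-- Power graphs: walks, components and cuts.

module Cuts {c ℓ} (G : AbelianGroup c ℓ) where
  open AbelianGroup G using (Carrier; _≈_; ε) renaming (refl to ≈-refl; sym to ≈-sym; trans to ≈-trans)
  open PowerGraph G
  open PowerLaws G using (IsPowerOf-resp)

  ≈ₑ-sym : ∀ {e e'} → e ≈ₑ e' → e' ≈ₑ e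
  ≈ₑ-sym (inj₁ (u≈u' , v≈v')) = inj₁ (≈-sym u≈u' , ≈-sym v≈v')
  ≈ₑ-sym (inj₂ (u≈v' , v≈u')) = inj₂ (≈-sym v≈u' , ≈-sym u≈v')

  ≈ₑ-trans : ∀ {e e' e''} → e ≈ₑ e' → e' ≈ₑ e'' → e ≈ₑ e''
  ≈ₑ-trans (inj₁ (a , b)) (inj₁ (c , d)) = inj₁ (≈-trans a c , ≈-trans b d)
  ≈ₑ-trans (inj₁ (a , b)) (inj₂ (c , d)) = inj₂ (≈-trans a c , ≈-trans b d)
  ≈ₑ-trans (inj₂ (a , b)) (inj₁ (c , d)) = inj₂ (≈-trans a d , ≈-trans b c)
  ≈ₑ-trans (inj₂ (a , b)) (inj₂ (c , d)) = inj₁ (≈-trans a d , ≈-trans b c)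

  Adj-sym : ∀ {u v} → Adj u v → Adj v u
  Adj-sym (u≉v , comparable) = (λ v≈u → u≉v (≈-sym v≈u)) , Sum.swap comparable

  Adj-respˡ : ∀ {u u' v} → u ≈ u' → Adj u' v → Adj u v
  Adj-respˡ u≈u' (u'≉v , comparable) =
    (λ u≈v → u'≉v (≈-trans (≈-sym u≈u') u≈v)) ,
    Sum.map (IsPowerOf-resp (≈-sym u≈u') ≈-refl) (IsPowerOf-resp ≈-refl (≈-sym u≈u')) comparable

  module Walks (L : List Edge) where
    without-sym : ∀ {u v} → AdjWithout L u v → AdjWithout L v u
    without-sym (adj , ∉L) =
      Adj-sym adj , λ vu∈L → ∉L (Any.map (≈ₑ-trans (inj₂ (≈-refl , ≈-refl))) vu∈L)

    without-respˡ : ∀ {u u' v} → u ≈ u' → AdjWithout L u' v → AdjWithout L u v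
    without-respˡ u≈u' (adj , ∉L) =
      Adj-respˡ u≈u' adj , λ uv∈L → ∉L (Any.map (≈ₑ-trans (inj₁ (≈-sym u≈u' , ≈-refl))) uv∈L)

    reach-respˡ : ∀ {u u' v} → u ≈ u' → Reach (AdjWithout L) u' v → Reach (AdjWithout L) u v
    reach-respˡ u≈u' (here u'≈v)     = here (≈-trans u≈u' u'≈v)
    reach-respˡ u≈u' (step edge walk) = step (without-respˡ u≈u' edge) walk

    reach-trans : ∀ {u w v} → Reach (AdjWithout L) u w → Reach (AdjWithout L) w v → Reach (AdjWithout L) u v
    reach-trans (here u≈w)      walk' = reach-respˡ u≈w walk'
    reach-trans (step edge walk) walk' = step edge (reach-trans walk walk')

    reach-sym : ∀ {u v} → Reach (AdjWithout L) u v → Reach (AdjWithout L) v u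
    reach-sym (here u≈v)       = here (≈-sym u≈v)
    reach-sym (step edge walk) = reach-trans (reach-sym walk) (step (without-sym edge) (here ≈-refl))

  components-nonempty : ∀ {r k} {R : Carrier → Carrier → Set r} → HasComponents R k → 1 ≤ k
  components-nonempty (reps , refl , _ , cover) with cover ε
  ... | here _  = s≤s z≤n
  ... | there _ = s≤s z≤n

  Neighbours : Carrier → ℕ → Set (c ⊔ ℓ)
  Neighbours x d = ∃ λ ys → length ys ≡ d × AllPairs (λ a b → ¬ a ≈ b) ys × All (λ y → Adj y x) ys

  -- From now on ≈ is decidable and ε is adjacent to every other vertex
  -- (both hold in the power graph of a finite group).
  module _ (_≈?_ : Decidable _≈_) (ε-adjacent : ∀ y → ¬ y ≈ ε → Adj ε y) where

    connected : HasComponents Adj 1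
    connected = ε ∷ [] , refl , [] ∷ [] , λ v → here (from-ε v)
      where
      from-ε : ∀ v → Reach Adj ε v
      from-ε v with v ≈? ε
      ... | yes v≈ε = here (≈-sym v≈ε)
      ... | no  v≉ε = step (ε-adjacent v v≉ε) (here ≈-refl)

    -- If L contains every edge at a vertex g ≉ ε, but no edge ε–v with v ≉ g,
    -- then 𝒢(G) − L has exactly the two components {g} and G ∖ {g}.
    isolating-cut : ∀ {g L} → ¬ g ≈ ε → (∀ {u w} → u ≈ g → Adj u w → (u , w) ∈ₑ L) →
                    (∀ {v} → ¬ v ≈ g → ¬ (ε , v) ∈ₑ L) → Disconnecting L
    isolating-cut {g} {L} g≉ε at-g∈L ε-edges∉L =
      1 , 2 , connected , (g ∷ ε ∷ [] , refl , (g↛ε ∷ []) ∷ [] ∷ [] , cover) , s≤s (s≤s z≤n)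
      where
      stuck : ∀ {u v} → Reach (AdjWithout L) u v → u ≈ g → v ≈ g
      stuck (here u≈v)          u≈g = ≈-trans (≈-sym u≈v) u≈g
      stuck (step (adj , ∉L) _) u≈g = contradiction (at-g∈L u≈g adj) ∉L
      g↛ε : ¬ Reach (AdjWithout L) g ε
      g↛ε walk = g≉ε (≈-sym (stuck walk ≈-refl))
      cover : ∀ v → Any (λ a → Reach (AdjWithout L) a v) (g ∷ ε ∷ [])
      cover v with v ≈? g | v ≈? ε
      ... | yes v≈g | _       = here (here (≈-sym v≈g))
      ... | no  _   | yes v≈ε = there (here (here (≈-sym v≈ε)))
      ... | no  v≉g | no  v≉ε = there (here (step (ε-adjacent v v≉ε , ε-edges∉L v≉g) (here ≈-refl)))

    -- The edge e cuts the walk ε — y — x (the second edge only matters when y ≉ ε).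
    Cuts-walk : Carrier → Carrier → Edge → Set ℓ
    Cuts-walk x y e = (y , x) ≈ₑ e ⊎ (¬ y ≈ ε × (ε , y) ≈ₑ e)

    _≈ₑ?_ : Decidable _≈ₑ_
    (u , v) ≈ₑ? (u' , v') = ((u ≈? u') ×-dec (v ≈? v')) ⊎-dec ((u ≈? v') ×-dec (v ≈? u'))

    cuts-walk? : ∀ x y e → Dec (Cuts-walk x y e)
    cuts-walk? x y e = ((y , x) ≈ₑ? e) ⊎-dec (¬? (y ≈? ε) ×-dec ((ε , y) ≈ₑ? e))

    cuts-walk-exclusive : ∀ {x y y' e} → ¬ y ≈ y' → ¬ y ≈ x → ¬ y' ≈ x →
                          Cuts-walk x y e → Cuts-walk x y' e → ⊥
    cuts-walk-exclusive y≉y' y≉x y'≉x (inj₁ a) (inj₁ b) with ≈ₑ-trans a (≈ₑ-sym b)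
    ... | inj₁ (y≈y' , _) = y≉y' y≈y'
    ... | inj₂ (y≈x , _)  = y≉x y≈x
    cuts-walk-exclusive y≉y' y≉x y'≉x (inj₁ a) (inj₂ (_ , b)) with ≈ₑ-trans a (≈ₑ-sym b)
    ... | inj₁ (_ , x≈y') = y'≉x (≈-sym x≈y')
    ... | inj₂ (y≈y' , _) = y≉y' y≈y'
    cuts-walk-exclusive y≉y' y≉x y'≉x (inj₂ (_ , a)) (inj₁ b) with ≈ₑ-trans a (≈ₑ-sym b)
    ... | inj₁ (_ , y≈x)  = y≉x y≈x
    ... | inj₂ (_ , y≈y') = y≉y' y≈y'
    cuts-walk-exclusive y≉y' y≉x y'≉x (inj₂ (y≉ε , a)) (inj₂ (_ , b)) with ≈ₑ-trans a (≈ₑ-sym b)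
    ... | inj₁ (_ , y≈y') = y≉y' y≈y'
    ... | inj₂ (_ , y≈ε)  = y≉ε y≈ε

    uncut-walk : ∀ {L x y} → Adj y x → ¬ Any (Cuts-walk x y) L → Reach (AdjWithout L) ε x
    uncut-walk {L} {x} {y} adj uncut = Walks.reach-trans L ε⇝y (step (adj , yx∉L) (here ≈-refl))
      where
      yx∉L : ¬ (y , x) ∈ₑ L
      yx∉L yx∈L = uncut (Any.map inj₁ yx∈L)
      ε⇝y : Reach (AdjWithout L) ε y
      ε⇝y with y ≈? ε
      ... | yes y≈ε = here (≈-sym y≈ε)
      ... | no  y≉ε = step (ε-adjacent y y≉ε , λ εy∈L → uncut (Any.map (λ εy≈e → inj₂ (y≉ε , εy≈e)) εy∈L))
                           (here ≈-refl)

    short-cuts-connect : ∀ {d} → (∀ x → ¬ x ≈ ε → Neighbours x d) →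
                         ∀ L → length L < d → ∀ x → Reach (AdjWithout L) ε x
    short-cuts-connect nbrs L short x with x ≈? ε
    ... | yes x≈ε = here (≈-sym x≈ε)
    ... | no  x≉ε with nbrs x x≉ε
    ...   | ys , refl , distinct , adjacent with All.all? (λ y → Any.any? (cuts-walk? x y) L) ys
    ...     | yes cut =
      contradiction (pigeonhole exclusive distinct (All.zipWith tag (adjacent , cut))) (<⇒≱ short)
      where
      -- each neighbour y ≉ x tags a distinct edge of L cutting its walk
      Cut-neighbour : Carrier → Edge → Set ℓ
      Cut-neighbour y e = ¬ y ≈ x × Cuts-walk x y e
      tag : ∀ {y} → Adj y x × Any (Cuts-walk x y) L → Any (Cut-neighbour y) L
      tag (adj , e∈L) = Any.map (proj₁ adj ,_) e∈L
      exclusive : ∀ {y y' e} → ¬ y ≈ y' → Cut-neighbour y e → Cut-neighbour y' e → ⊥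
      exclusive y≉y' (y≉x , a) (y'≉x , b) = cuts-walk-exclusive y≉y' y≉x y'≉x a b
    ...     | no ¬cut =
      let adj , uncut = All.lookupAny adjacent (All.¬All⇒Any¬ (λ y → Any.any? (cuts-walk? x y) L) ys ¬cut)
      in uncut-walk adj uncut

    cut-bound : ∀ {d} → (∀ x → ¬ x ≈ ε → Neighbours x d) → ∀ L → Disconnecting L → d ≤ length L
    cut-bound {d} nbrs L (k , k' , components , components' , k<k') with d ≤? length L
    ... | yes d≤ = d≤
    ... | no  d≰ =
      contradiction (at-most-one components') (<⇒≱ (≤-<-trans (components-nonempty components) k<k'))
      where
      open Walks L
      from-ε : ∀ v → Reach (AdjWithout L) ε v
      from-ε = short-cuts-connect nbrs L (≰⇒> d≰)
      at-most-one : ∀ {k} → HasComponents (AdjWithout L) k → k ≤ 1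
      at-most-one ([]          , refl , _                  , _) = z≤n
      at-most-one (_ ∷ []      , refl , _                  , _) = s≤s z≤n
      at-most-one (a ∷ b ∷ _   , refl , (a↛b ∷ _) ∷ _      , _) =
        contradiction (reach-trans (reach-sym (from-ε a)) (from-ε b)) a↛b

-- Abelian groups of exponent p^S (p prime), such as finite abelian p-groups.

module PGroup {c ℓ} (G : AbelianGroup c ℓ) where
  open AbelianGroup G renaming (refl to ≈-refl; sym to ≈-sym; trans to ≈-trans; reflexive to ≈-reflexive)
  open PowerGraph G
  open PowerLaws G
  open Cuts G using (Neighbours)
  open import Relation.Binary.Reasoning.Setoid setoid

  module _ {p} (pp : Prime p) (S : ℕ) (exponent : ∀ x → pow x (p ^ S) ≈ ε) where
    private instance
      p≢0 : NonZero p
      p≢0 = prime⇒nonZero pp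
      N≢0 : NonZero (p ^ S)
      N≢0 = m^n≢0 p S

    ε-adjacent : ∀ y → ¬ y ≈ ε → Adj ε y
    ε-adjacent y y≉ε = (λ ε≈y → y≉ε (≈-sym ε≈y)) , inj₁ (p ^ S , m^n>0 p S , ≈-sym (exponent y))

    unit-power-invertible : ∀ {k} → ¬ p ∣ k → ∃ λ k' → 1 ≤ k' × ∀ x → pow (pow x k) k' ≈ x
    unit-power-invertible {k} p∤k =
      let k' , k'≥1 , kk'≡1 = %-inverse (coprime-^ pp p∤k S) in
      k' , k'≥1 , λ x → begin
        pow (pow x k) k'         ≈⟨ pow-pow x k k' ⟩
        pow x (k * k')           ≈⟨ pow-% x (p ^ S) (exponent x) (k * k') ⟩
        pow x ((k * k') % p ^ S) ≡⟨ cong (pow x) kk'≡1 ⟩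
        pow x (1 % p ^ S)        ≈⟨ pow-% x (p ^ S) (exponent x) 1 ⟨
        pow x 1                  ≈⟨ pow-one x ⟩
        x                        ∎

    comparable : ∀ z s j → 1 ≤ j → IsPowerOf (pow z j) (pow z (p ^ s)) ⊎ IsPowerOf (pow z (p ^ s)) (pow z j)
    comparable z zero j j≥1 =
      inj₁ (j , j≥1 , ≈-sym (≈-trans (pow-pow z 1 j) (≈-reflexive (cong (pow z) (*-identityˡ j)))))
    comparable z (suc s) j j≥1 with p ∣? j
    ... | no p∤j =
      let k' , k'≥1 , invert = unit-power-invertible p∤j in
      inj₂ (k' * p ^ suc s , *-mono-≤ k'≥1 (m^n>0 p (suc s)) , (begin
        pow z (p ^ suc s)                   ≈⟨ pow-cong (p ^ suc s) (invert z) ⟨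
        pow (pow (pow z j) k') (p ^ suc s)  ≈⟨ pow-pow (pow z j) k' (p ^ suc s) ⟩
        pow (pow z j) (k' * p ^ suc s)      ∎))
    ... | yes (divides q refl) =
      Sum.map (IsPowerOf-resp zᵖᑫ≈zʲ zᵖᵖˢ≈zᵖˢ) (IsPowerOf-resp zᵖᵖˢ≈zᵖˢ zᵖᑫ≈zʲ) (comparable (pow z p) s q q≥1)
      where
      q≥1 : 1 ≤ q
      q≥1 = n≢0⇒n>0 (λ q≡0 → <⇒≢ j≥1 (sym (cong (_* p) q≡0)))
      zᵖᑫ≈zʲ : pow (pow z p) q ≈ pow z (q * p)
      zᵖᑫ≈zʲ = ≈-trans (pow-pow z p q) (≈-reflexive (cong (pow z) (*-comm p q)))
      zᵖᵖˢ≈zᵖˢ : pow (pow z p) (p ^ s) ≈ pow z (p ^ suc s)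
      zᵖᵖˢ≈zᵖˢ = pow-pow z p (p ^ s)

    power-of-non-p-th-power : ∀ {x w} → (∀ y → ¬ x ≈ pow y p) → IsPowerOf x w → IsPowerOf w x
    power-of-non-p-th-power {x} {w} not-p-th (k , k≥1 , x≈wᵏ) with p ∣? k
    ... | yes (divides q refl) = contradiction (≈-trans x≈wᵏ (≈-sym (pow-pow w q p))) (not-p-th (pow w q))
    ... | no p∤k =
      let k' , k'≥1 , invert = unit-power-invertible p∤k in
      k' , k'≥1 , ≈-trans (≈-sym (invert w)) (pow-cong k' (≈-sym x≈wᵏ))

    neighbours-in-⟨z⟩ : ∀ {m z s x} → OrderAtLeast m z → p ^ s ≤ m → x ≈ pow z (p ^ s) → Neighbours x (pred m)
    neighbours-in-⟨z⟩ {m} {z} {s} {x} order pˢ≤m x≈zᵖˢ =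
      (powers z m Any.─ x∈) , length-others , ─-pairwise distinct x∈ ,
      All.zip (─-avoids setoid distinct x∈ , All.─⁺ x∈ comparable-with-x)
      where
      distinct : AllPairs (λ a b → ¬ a ≈ b) (powers z m)
      distinct = powers-distinct order
      x∈ : Any (x ≈_) (powers z m)
      x∈ = Any.map (≈-trans x≈zᵖˢ) (∈-powers (m^n>0 p s) pˢ≤m)
      length-others : length (powers z m Any.─ x∈) ≡ pred m
      length-others = trans (length-removeAt (powers z m) (Any.index x∈))
                            (cong pred (length-applyUpTo (λ i → pow z (suc i)) m))
      comparable-with-x : All (λ y → IsPowerOf y x ⊎ IsPowerOf x y) (powers z m)
      comparable-with-x = All.applyUpTo⁺₁ _ m λ {i} _ →
        Sum.map (IsPowerOf-resp ≈-refl (≈-sym x≈zᵖˢ)) (IsPowerOf-resp (≈-sym x≈zᵖˢ) ≈-refl)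
                (comparable z s (suc i) (s≤s z≤n))

-- Coordinates: transporting powers along an isomorphism ψ : G ≅ ℤ_{p^α₁} × ⋯ × ℤ_{p^α_r}.

module Coordinates {c ℓ} (G : AbelianGroup c ℓ) (p : ℕ) (pp : Prime p) {r : ℕ} (α : Fin r → ℕ)
  (ψ : AbelianGroup.Carrier G → CyclicProduct.Carrier p pp α)
  (iso : GroupMorphisms.IsGroupIsomorphism (AbelianGroup.rawGroup G) (CyclicProduct.rawGroup p pp α) ψ)
  where

  open AbelianGroup G using (Carrier; _≈_; ε) renaming (sym to ≈-sym; trans to ≈-trans)
  open PowerGraph G using (pow)
  open PowerLaws G using (OrderAtLeast; pow-⁻¹)
  open CyclicProduct p pp α using (0#; -_; _·_; _∈⟨_⟩) renaming (Carrier to Tuple; _≈_ to _≋_; _+_ to _⊕_)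
  open GroupMorphisms.IsGroupIsomorphism iso using (∙-homo; ε-homo; ⁻¹-homo; injective; surjective)
    renaming (⟦⟧-cong to ψ-cong)

  private instance
    p≢0 : NonZero p
    p≢0 = prime⇒nonZero pp
    pᵅ≢0 : ∀ {i} → NonZero (p ^ α i)
    pᵅ≢0 {i} = m^n≢0 p (α i)

  ≋-sym : ∀ {X Y} → X ≋ Y → Y ≋ X
  ≋-sym X≋Y i = sym (X≋Y i)

  ≋-trans : ∀ {X Y Z} → X ≋ Y → Y ≋ Z → X ≋ Z
  ≋-trans X≋Y Y≋Z i = trans (X≋Y i) (Y≋Z i)

  ≋-coords : ∀ {X Y} → (∀ i → toℕ (X i) ≡ toℕ (Y i)) → X ≋ Y
  ≋-coords eq i = toℕ-injective (eq i)

  coord-· : ∀ n X i → toℕ (((+ n) · X) i) ≡ (n * toℕ (X i)) % p ^ α i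
  coord-· n X i = toℕ-fromℕ< _

  coord-0 : ∀ i → toℕ (0# i) ≡ 0
  coord-0 i = trans (toℕ-fromℕ< _) (m*n%n≡0 0 (p ^ α i))

  ψ-reflects : ∀ {x y} → ψ x ≋ ψ y → x ≈ y
  ψ-reflects = injective

  preimage : Tuple → Carrier
  preimage Y = proj₁ (surjective Y)

  ψ-preimage : ∀ Y → ψ (preimage Y) ≋ Y
  ψ-preimage Y = proj₂ (surjective Y) (AbelianGroup.refl G)

  ψ-pow : ∀ x n → ψ (pow x n) ≋ ((+ n) · ψ x)
  ψ-pow x zero    = ε-homo
  ψ-pow x (suc n) = ≋-trans (∙-homo x (pow x n)) (≋-coords λ i → begin
    toℕ ((ψ x ⊕ ψ (pow x n)) i)                       ≡⟨ toℕ-fromℕ< _ ⟩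
    (toℕ (ψ x i) + toℕ (ψ (pow x n) i)) % p ^ α i     ≡⟨ cong (λ v → (toℕ (ψ x i) + toℕ v) % p ^ α i) (ψ-pow x n i) ⟩
    (toℕ (ψ x i) + toℕ (((+ n) · ψ x) i)) % p ^ α i   ≡⟨ cong (λ v → (toℕ (ψ x i) + v) % p ^ α i) (coord-· n (ψ x) i) ⟩
    (toℕ (ψ x i) + (n * toℕ (ψ x i)) % p ^ α i) % p ^ α i ≡⟨ +-%-absorb (toℕ (ψ x i)) _ (p ^ α i) ⟩
    (toℕ (ψ x i) + n * toℕ (ψ x i)) % p ^ α i         ≡⟨ coord-· (suc n) (ψ x) i ⟨
    toℕ (((+ suc n) · ψ x) i)                         ∎)
    where open ≡-Reasoning

  _≈?_ : Decidable _≈_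
  x ≈? y = Dec.map′ ψ-reflects ψ-cong (all? (λ i → ψ x i Fin.≟ ψ y i))

  ψ≋0⇒≈ε : ∀ {x} → (∀ i → toℕ (ψ x i) ≡ 0) → x ≈ ε
  ψ≋0⇒≈ε ψx≡0 = ψ-reflects (≋-coords λ i → trans (ψx≡0 i) (sym (trans (cong toℕ (ε-homo i)) (coord-0 i))))

  exponent : ∀ x → pow x (p ^ sumᶠ α) ≈ ε
  exponent x = ψ≋0⇒≈ε λ i → begin
    toℕ (ψ (pow x (p ^ sumᶠ α)) i)               ≡⟨ cong toℕ (ψ-pow x (p ^ sumᶠ α) i) ⟩
    toℕ (((+ p ^ sumᶠ α) · ψ x) i)               ≡⟨ coord-· (p ^ sumᶠ α) (ψ x) i ⟩
    (p ^ sumᶠ α * toℕ (ψ x i)) % p ^ α i         ≡⟨ n∣m⇒m%n≡0 _ _ (∣m⇒∣m*n _ (^-∣ p (≤-sumᶠ α i))) ⟩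
    0                                            ∎
    where open ≡-Reasoning

  ∈⟨⟩⇒power : ∀ {x y} → ψ y ∈⟨ ψ x ⟩ → ∃ λ n → y ≈ pow x n
  ∈⟨⟩⇒power {x} {y} (+ n , ψy≋) = n , ψ-reflects (≋-trans ψy≋ (≋-sym (ψ-pow x n)))
  ∈⟨⟩⇒power {x} {y} (-[1+ k ] , ψy≋) =
    suc k * pred (p ^ sumᶠ α) ,
    ≈-trans (ψ-reflects (≋-trans ψy≋ (≋-trans negated (≋-sym (⁻¹-homo (pow x (suc k)))))))
            (pow-⁻¹ x (pred (p ^ sumᶠ α)) (suc k) x^N≈ε)
    where
    negated : (-[1+ k ] · ψ x) ≋ (- ψ (pow x (suc k)))
    negated i = cong (λ v → (p ^ α i ∸ toℕ v) mod p ^ α i) (sym (ψ-pow x (suc k) i))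
    x^N≈ε : pow x (suc (pred (p ^ sumᶠ α))) ≈ ε
    x^N≈ε = subst (λ e → pow x e ≈ ε) (sym (suc-pred (p ^ sumᶠ α) {{m^n≢0 p (sumᶠ α)}})) (exponent x)

  power⇒∈⟨⟩ : ∀ {x y n} → y ≈ pow x n → ψ y ∈⟨ ψ x ⟩
  power⇒∈⟨⟩ {x} {n = n} y≈xⁿ = + n , ≋-trans (ψ-cong y≈xⁿ) (ψ-pow x n)

  order-from-coordinate : ∀ {z a} i → a ≤ α i → ¬ p ^ suc (α i ∸ a) ∣ toℕ (ψ z i) → OrderAtLeast (p ^ a) z
  order-from-coordinate {z} {a} i a≤αᵢ not-divisible d d≥1 d<pᵃ zᵈ≈ε =
    <⇒≱ d<pᵃ (∣⇒≤ {{>-nonZero d≥1}} pᵃ∣d)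
    where
    open ≡-Reasoning
    dzᵢ≡0 : (d * toℕ (ψ z i)) % p ^ α i ≡ 0
    dzᵢ≡0 = begin
      (d * toℕ (ψ z i)) % p ^ α i ≡⟨ coord-· d (ψ z) i ⟨
      toℕ (((+ d) · ψ z) i)       ≡⟨ cong toℕ (ψ-pow z d i) ⟨
      toℕ (ψ (pow z d) i)         ≡⟨ cong toℕ (ψ-cong zᵈ≈ε i) ⟩
      toℕ (ψ ε i)                 ≡⟨ cong toℕ (ε-homo i) ⟩
      toℕ (0# i)                  ≡⟨ coord-0 i ⟩
      0                           ∎
    pᵃ∣d : p ^ a ∣ d
    pᵃ∣d = ^∣-cancel pp (α i ∸ a)
             (subst (λ e → p ^ e ∣ d * toℕ (ψ z i)) (sym (m∸n+n≡m a≤αᵢ)) (m%n≡0⇒n∣m _ _ dzᵢ≡0))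
             not-divisible

  root : ∀ {a} → (∀ i → a ≤ α i) → ∀ {x} → ¬ x ≈ ε →
         ∃₂ λ s z → s ≤ a × x ≈ pow z (p ^ s) × OrderAtLeast (p ^ a) z
  root {a} a≤α {x} x≉ε with peel (λ i → α i ∸ a) a (λ i → toℕ (ψ x i)) bounded (λ ψx≡0 → x≉ε (ψ≋0⇒≈ε ψx≡0))
    where
    bounded : ∀ i → toℕ (ψ x i) < p ^ (a + (α i ∸ a))
    bounded i = subst (λ e → toℕ (ψ x i) < p ^ e) (sym (m+[n∸m]≡n (a≤α i))) (toℕ<n (ψ x i))
  ... | s , zs , s≤a , (i , not-divisible) , xᵢ≡pˢzᵢ =
    s , z , s≤a , ψ-reflects (≋-coords xᵢ≡) ,
    order-from-coordinate i (a≤α i) (subst (λ v → ¬ p ^ suc (α i ∸ a) ∣ v) (sym (zᵢ≡ i)) not-divisible)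
    where
    open ≡-Reasoning
    zs< : ∀ i → zs i < p ^ α i
    zs< i = ≤-<-trans (m≤n*m (zs i) (p ^ s) {{m^n≢0 p s}}) (subst (_< p ^ α i) (xᵢ≡pˢzᵢ i) (toℕ<n (ψ x i)))
    z : Carrier
    z = preimage (λ i → fromℕ< (zs< i))
    zᵢ≡ : ∀ i → toℕ (ψ z i) ≡ zs i
    zᵢ≡ i = trans (cong toℕ (ψ-preimage _ i)) (toℕ-fromℕ< (zs< i))
    xᵢ≡ : ∀ i → toℕ (ψ x i) ≡ toℕ (ψ (pow z (p ^ s)) i)
    xᵢ≡ i = begin
      toℕ (ψ x i)                         ≡⟨ m<n⇒m%n≡m (toℕ<n (ψ x i)) ⟨
      toℕ (ψ x i) % p ^ α i               ≡⟨ cong (_% p ^ α i) (xᵢ≡pˢzᵢ i) ⟩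
      (p ^ s * zs i) % p ^ α i            ≡⟨ cong (λ v → (p ^ s * v) % p ^ α i) (zᵢ≡ i) ⟨
      (p ^ s * toℕ (ψ z i)) % p ^ α i     ≡⟨ coord-· (p ^ s) (ψ z) i ⟨
      toℕ (((+ p ^ s) · ψ z) i)           ≡⟨ cong toℕ (ψ-pow z (p ^ s) i) ⟨
      toℕ (ψ (pow z (p ^ s)) i)           ∎

  module Generator (t : Fin r) (g : Carrier) (g-off : ∀ i → ¬ i ≡ t → toℕ (ψ g i) ≡ 0)
                   (g-unit : ¬ p ∣ toℕ (ψ g t)) where

    g≉ε : ¬ g ≈ ε
    g≉ε g≈ε = g-unit (subst (p ∣_) (sym (trans (cong toℕ (≋-trans (ψ-cong g≈ε) ε-homo t)) (coord-0 t))) (p ∣0))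

    g-order : OrderAtLeast (p ^ α t) g
    g-order = order-from-coordinate t ≤-refl (λ d → g-unit (∣-trans (m∣m*n _) d))

    g-period : pow g (p ^ α t) ≈ ε
    g-period = ψ≋0⇒≈ε λ i → begin
      toℕ (ψ (pow g (p ^ α t)) i)            ≡⟨ cong toℕ (ψ-pow g (p ^ α t) i) ⟩
      toℕ (((+ p ^ α t) · ψ g) i)            ≡⟨ coord-· (p ^ α t) (ψ g) i ⟩
      (p ^ α t * toℕ (ψ g i)) % p ^ α i      ≡⟨ n∣m⇒m%n≡0 _ _ (divisible i) ⟩
      0                                      ∎
      where
      open ≡-Reasoning
      divisible : ∀ i → p ^ α i ∣ p ^ α t * toℕ (ψ g i)
      divisible i with i Fin.≟ t
      ... | yes refl = m∣m*n (toℕ (ψ g t))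
      ... | no  i≢t  = subst (λ v → p ^ α i ∣ p ^ α t * v) (sym (g-off i i≢t))
                         (subst (p ^ α i ∣_) (sym (*-zeroʳ (p ^ α t))) ((p ^ α i) ∣0))

    -- Coordinate t of a p-th power is divisible by p, so g is not a p-th power.
    g-not-p-th-power : 1 ≤ α t → ∀ y → ¬ g ≈ pow y p
    g-not-p-th-power αₜ≥1 y g≈yᵖ = g-unit (subst (p ∣_) (sym gₜ≡) (%-presˡ-∣ (m∣m*n _) p∣pᵅᵗ))
      where
      open ≡-Reasoning
      p∣pᵅᵗ : p ∣ p ^ α t
      p∣pᵅᵗ = subst (_∣ p ^ α t) (*-identityʳ p) (^-∣ p αₜ≥1)
      gₜ≡ : toℕ (ψ g t) ≡ (p * toℕ (ψ y t)) % p ^ α t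
      gₜ≡ = begin
        toℕ (ψ g t)                    ≡⟨ cong toℕ (ψ-cong g≈yᵖ t) ⟩
        toℕ (ψ (pow y p) t)            ≡⟨ cong toℕ (ψ-pow y p t) ⟩
        toℕ (((+ p) · ψ y) t)          ≡⟨ coord-· p (ψ y) t ⟩
        (p * toℕ (ψ y t)) % p ^ α t    ∎

module MinimumCut {c ℓ} (G : AbelianGroup c ℓ) (p : ℕ) (pp : Prime p) {r : ℕ} (α : Fin r → ℕ)
  (ψ : AbelianGroup.Carrier G → CyclicProduct.Carrier p pp α)
  (iso : GroupMorphisms.IsGroupIsomorphism (AbelianGroup.rawGroup G) (CyclicProduct.rawGroup p pp α) ψ)
  (t : Fin r) (t-minimal : ∀ i → α t ≤ α i) (αₜ≥1 : 1 ≤ α t)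
  (g : AbelianGroup.Carrier G) (g-off : ∀ i → ¬ i ≡ t → toℕ (ψ g i) ≡ 0) (g-unit : ¬ p ∣ toℕ (ψ g t))
  where

  open AbelianGroup G using (Carrier; _≈_; ε; setoid) renaming (refl to ≈-refl; sym to ≈-sym; trans to ≈-trans)
  open PowerGraph G
  open PowerLaws G
  open PGroup G
  open Cuts G
  open Coordinates G p pp α ψ iso
  open Generator t g g-off g-unit

  private instance
    p≢0 : NonZero p
    p≢0 = prime⇒nonZero pp
    τ≢0 : NonZero (p ^ α t)
    τ≢0 = m^n≢0 p (α t)

  τ : ℕ
  τ = p ^ α t

  ε-adjacent-to-all : ∀ y → ¬ y ≈ ε → Adj ε y
  ε-adjacent-to-all = ε-adjacent pp (sumᶠ α) exponent

  neighbours : ∀ x → ¬ x ≈ ε → Neighbours x (pred τ)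
  neighbours x x≉ε =
    let s , z , s≤αₜ , x≈zᵖˢ , order = root t-minimal x≉ε
    in neighbours-in-⟨z⟩ pp (sumᶠ α) exponent {s = s} order (^-monoʳ-≤ p s≤αₜ) x≈zᵖˢ

  -- All neighbours of g lie in ⟨g⟩, since g is not a p-th power.
  neighbour-of-g : ∀ {w} → Adj g w → IsPowerOf w g
  neighbour-of-g (_ , inj₁ g-power-of-w) =
    power-of-non-p-th-power pp (sumᶠ α) exponent (g-not-p-th-power αₜ≥1) g-power-of-w
  neighbour-of-g (_ , inj₂ w-power-of-g) = w-power-of-g

  B : Carrier → Set ℓ
  B x = CyclicProduct._∈⟨_⟩ p pp α (ψ x) (ψ g) × ¬ x ≈ g

  g∈powers : Any (g ≈_) (powers g τ)
  g∈powers = Any.map (≈-trans (≈-sym (pow-one g))) (∈-powers (s≤s z≤n) (>-nonZero⁻¹ τ))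

  others : List Carrier
  others = powers g τ Any.─ g∈powers

  others-distinct : AllPairs (λ a b → ¬ a ≈ b) others
  others-distinct = ─-pairwise (powers-distinct g-order) g∈powers

  others-≉g : All (λ y → ¬ y ≈ g) others
  others-≉g = ─-avoids setoid (powers-distinct g-order) g∈powers

  others-powers : All (λ y → IsPowerOf y g) others
  others-powers = All.─⁺ g∈powers (powers-are-powers g τ)

  others-complete : ∀ {y} → B y → Any (y ≈_) others
  others-complete {y} (y∈⟨g⟩ , y≉g) =
    let n , y≈gⁿ = ∈⟨⟩⇒power y∈⟨g⟩
        j , j≥1 , j≤τ , gⁿ≈gʲ = pow-reduce g τ g-period n
    in survive g∈powers (Any.map (≈-trans (≈-trans y≈gⁿ gⁿ≈gʲ)) (∈-powers j≥1 j≤τ))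
               (λ g≈v y≈v → y≉g (≈-trans y≈v (≈-sym g≈v)))

  L : List Edge
  L = map (g ,_) others

  L-length : length L ≡ pred τ
  L-length = trans (length-map (g ,_) others)
                   (trans (length-removeAt (powers g τ) (Any.index g∈powers))
                          (cong pred (length-applyUpTo (λ i → pow g (suc i)) τ)))

  adjacent-others : All (λ y → Adj g y) others
  adjacent-others = All.zipWith (λ (y≉g , y-power) → (λ g≈y → y≉g (≈-sym g≈y)) , inj₂ y-power)
                                (others-≉g , others-powers)

  others-in-B : All B others
  others-in-B = All.zipWith (λ (y≉g , (k , _ , y≈gᵏ)) → power⇒∈⟨⟩ {n = k} y≈gᵏ , y≉g)
                            (others-≉g , others-powers)

  L-distinct : AllPairs (λ e e' → ¬ (e ≈ₑ e')) L
  L-distinct = AllPairs.map⁺ (AllPairs.map distinct-edges others-distinct)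
    where
    distinct-edges : ∀ {y y'} → ¬ y ≈ y' → ¬ ((g , y) ≈ₑ (g , y'))
    distinct-edges y≉y' (inj₁ (_ , y≈y')) = y≉y' y≈y'
    distinct-edges y≉y' (inj₂ (g≈y' , y≈g)) = y≉y' (≈-trans y≈g g≈y')

  L-complete : ∀ e → E[ g , B ] e → e ∈ₑ L
  L-complete (u , v) (_ , inj₁ (u≈g , v∈B)) =
    Any.map⁺ (Any.map (λ v≈y → inj₁ (u≈g , v≈y)) (others-complete v∈B))
  L-complete (u , v) (_ , inj₂ (v≈g , u∈B)) =
    Any.map⁺ (Any.map (λ u≈y → inj₂ (u≈y , v≈g)) (others-complete u∈B))

  L-enumerates : Enumerates L (E[ g , B ])
  L-enumerates =
    All.map⁺ (All.zipWith (λ (adj , y∈B) → adj , inj₁ (≈-refl , y∈B)) (adjacent-others , others-in-B)) ,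
    L-distinct , L-complete

  L-edge-set : IsEdgeSet L
  L-edge-set = All.map⁺ adjacent-others , L-distinct

  L-disconnecting : Disconnecting L
  L-disconnecting = isolating-cut _≈?_ ε-adjacent-to-all g≉ε at-g∈L ε-edges∉L
    where
    at-g∈L : ∀ {u w} → u ≈ g → Adj u w → (u , w) ∈ₑ L
    at-g∈L {u} {w} u≈g adj = L-complete (u , w) (adj , inj₁ (u≈g , power⇒∈⟨⟩ {n = k} w≈gᵏ , w≉g))
      where
      w-power-of-g : IsPowerOf w g
      w-power-of-g = neighbour-of-g (Adj-respˡ (≈-sym u≈g) adj)
      k : ℕ
      k = proj₁ w-power-of-g
      w≈gᵏ : w ≈ pow g k
      w≈gᵏ = proj₂ (proj₂ w-power-of-g)
      w≉g : ¬ w ≈ g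
      w≉g w≈g = proj₁ adj (≈-trans u≈g (≈-sym w≈g))
    ε-edges∉L : ∀ {v} → ¬ v ≈ g → ¬ (ε , v) ∈ₑ L
    ε-edges∉L v≉g εv∈L with Any.satisfied (Any.map⁻ εv∈L)
    ... | _ , inj₁ (ε≈g , _) = g≉ε (≈-sym ε≈g)
    ... | _ , inj₂ (_ , v≈g) = v≉g v≈g

theorem5p2 : {c ℓ : Level} (G : AbelianGroup c ℓ)
    (p : ℕ) (pp : Prime p) (r : ℕ) (α : Fin r → ℕ) →
    (∀ i → 1 ≤ α i) →
    (ψ : AbelianGroup.Carrier G → CyclicProduct.Carrier p pp α) →
    GroupMorphisms.IsGroupIsomorphism (AbelianGroup.rawGroup G) (CyclicProduct.rawGroup p pp α) ψ →
    (t : Fin r) → (∀ i → p ^ α t ≤ p ^ α i) →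
    (g : AbelianGroup.Carrier G) →
    (∀ i → ¬ (i ≡ t) → toℕ (ψ g i) ≡ 0) →
    gcd (toℕ (ψ g t)) p ≡ 1 →
    ∃[ L ] (PowerGraph.Enumerates G L
              (PowerGraph.E[_,_] G g
                (λ x → CyclicProduct._∈⟨_⟩ p pp α (ψ x) (ψ g) × ¬ (AbelianGroup._≈_ G x g)))
            × PowerGraph.IsMinDisconnecting G L)
theorem5p2 G p pp r α α≥1 ψ iso t τ-minimal g g-off gcd≡1 =
  L , L-enumerates , L-edge-set , L-disconnecting ,
  λ L' _ L'-disconnecting → subst (_≤ length L') (sym L-length)
                              (cut-bound _≈?_ ε-adjacent-to-all neighbours L' L'-disconnecting)
  where
  p>1 : 1 < p
  p>1 = nonTrivial⇒n>1 p {{prime⇒nonTrivial pp}}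
  open MinimumCut G p pp α ψ iso t (λ i → ^-cancelʳ-≤ p>1 (τ-minimal i)) (α≥1 t) g g-off (gcd≡1⇒∤ pp gcd≡1)
  open Cuts G using (cut-bound)
  open Coordinates G p pp α ψ iso using (_≈?_)
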